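{- A set system $H=(U,(A_1,\dots,A_m))$ is harmonic if and only if $|H_{I_1,I_2}|=|H_{J_1,J_2}|$ for all equivalent pairs $(I_1,I_2)\sim(J_1,J_2)$.
   Context: For $I_1,I_2\subseteq[m]$, $H_{I_1,I_2}=\bigcap_{i\in I_1}A_i\cap\bigcap_{i\in I_2}(U\setminus A_i)$, each intersection over an empty index set being $U$; $H_I=H_{I,\varnothing}$. The run decomposition of a finite set $I$ of positive integers is the partition formed by the sizes, sorted nonincreasingly, of the maximal runs of consecutive integers in $I$. $H$ is harmonic if $|H_I|=|H_J|$ whenever $I,J\subseteq[m]$ have the same run decomposition. Two pairs $(I_1,I_2),(J_1,J_2)$ of subsets of $[m]$ with $I_1\cap I_2=J_1\cap J_2=\varnothing$ are equivalent, written $(I_1,I_2)\sim(J_1,J_2)$, if there is a bijection $\sigma:[m]\to[m]$ with $\sigma(I_1)=J_1$, $\sigma(I_2)=J_2$, and such that for all $i,j\in I_1\cup I_2$, $|\sigma(i)-\sigma(j)|=1$ if and only if $|i-j|=1$. -}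

module Defs where

open import Data.Bool using (Bool; true; false; not; _∧_; _∨_)
open import Data.Nat using (ℕ; zero; suc; ∣_-_∣)
open import Data.Fin using (Fin; toℕ)
open import Data.Fin.Subset using (Subset; _∈_; ∣_∣)
open import Data.Vec using (Vec; []; _∷_; lookup; tabulate; toList)
open import Data.List using (List; []; _∷_; _++_; allFin)
open import Data.Bool.ListAction using (all)
open import Data.List.Relation.Binary.Permutation.Propositional using (_↭_)
open import Data.Product using (_×_)
open import Data.Empty using (⊥)
open import Relation.Binary.PropositionalEquality using (_≡_)
open import Function.Bundles using (_↔_; Inverse; _⇔_)

-- A set system H = (U, (A_1,…,A_m)) with finite universe U = Fin n and
-- sets A i ⊆ U (i : Fin m, 0-based indexing of [m]).
SetSystem : ℕ → ℕ → Set
SetSystem n m = Fin m → Subset n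

-- H_{I1,I2} = ⋂_{i∈I1} A_i ∩ ⋂_{i∈I2} (U ∖ A_i)   (empty intersections = U)
H₂ : ∀ {n m} → SetSystem n m → Subset m → Subset m → Subset n
H₂ {n} {m} A I₁ I₂ = tabulate λ x →
  all (λ i → (not (lookup I₁ i) ∨ lookup (A i) x)
           ∧ (not (lookup I₂ i) ∨ not (lookup (A i) x)))
      (allFin m)

H₁ : ∀ {n m} → SetSystem n m → Subset m → Subset n
H₁ {m = m} A I = H₂ A I (tabulate λ _ → false)

-- Lengths of maximal runs of consecutive elements (in order of occurrence)
-- of a subset given as its characteristic list.
flush : ℕ → List ℕ
flush zero = []
flush (suc k) = suc k ∷ []

runsFrom : ℕ → List Bool → List ℕ
runsFrom k [] = flush k
runsFrom k (true ∷ bs) = runsFrom (suc k) bs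
runsFrom k (false ∷ bs) = flush k ++ runsFrom 0 bs

runLengths : ∀ {m} → Subset m → List ℕ
runLengths I = runsFrom 0 (toList I)

-- Same run decomposition: the multisets of run sizes coincide
-- (equivalently, their nonincreasingly sorted lists are equal).
SameRunDecomposition : ∀ {m} → Subset m → Subset m → Set
SameRunDecomposition I J = runLengths I ↭ runLengths J

Harmonic : ∀ {n m} → SetSystem n m → Set
Harmonic {m = m} A = (I J : Subset m) → SameRunDecomposition I J →
  ∣ H₁ A I ∣ ≡ ∣ H₁ A J ∣

Disjoint : ∀ {m} → Subset m → Subset m → Set
Disjoint {m} I₁ I₂ = (i : Fin m) → i ∈ I₁ → i ∈ I₂ → ⊥

Adjacent : ∀ {m} → Fin m → Fin m → Set
Adjacent i j = ∣ toℕ i - toℕ j ∣ ≡ 1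

Witness : ∀ {m} → (Fin m ↔ Fin m) → Subset m → Subset m → Subset m → Subset m → Set
Witness {m} σ I₁ I₂ J₁ J₂ =
    ((i : Fin m) → (i ∈ I₁ ⇔ Inverse.to σ i ∈ J₁))
  × ((i : Fin m) → (i ∈ I₂ ⇔ Inverse.to σ i ∈ J₂))
  × ((i j : Fin m) → (i ∈ I₁ Data.Sum.⊎ i ∈ I₂) → (j ∈ I₁ Data.Sum.⊎ j ∈ I₂) →
       (Adjacent (Inverse.to σ i) (Inverse.to σ j) ⇔ Adjacent i j))
  where import Data.Sum

Equivalent : ∀ {m} → Subset m → Subset m → Subset m → Subset m → Set
Equivalent {m} I₁ I₂ J₁ J₂ =
  Disjoint I₁ I₂ × Disjoint J₁ J₂ ×
  Data.Product.Σ (Fin m ↔ Fin m) (λ σ → Witness σ I₁ I₂ J₁ J₂)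
  where import Data.Product

{-# OPTIONS --safe #-}
-- A subset I ⊆ [m] is viewed as the subgraph of the path 0 — 1 — ⋯ — (m - 1) induced by
-- its members; its connected components are the runs of I.  A witness of (I, ∅) ∼ (J, ∅) is
-- exactly an isomorphism of these graphs, and two disjoint unions of paths are isomorphic iff
-- their multisets of component sizes agree.  Invariance of the run sizes comes from counting,
-- for each v, the members lying in runs of size v.  Conversely, false ∷ I is a concatenation
-- of blocks false ∷ trueᵏ (one per run, and k = 0 for the remaining non-members), blocks may be
-- permuted freely, and the leading false can be cancelled.
-- For "only if" induct on I₂: for k ∈ I₂, splitting by membership in A k gives
-- |H_{I₁,I₂∖k}| = |H_{I₁∪k,I₂∖k}| + |H_{I₁,I₂}|, and the same σ witnesses the two pairs with
-- the smaller second component I₂∖k; when I₂ = ∅, σ is an isomorphism I₁ ≅ J₁ and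
-- harmonicity applies.

module Submission where

open import Defs

open import Data.Bool using (Bool; true; false; not; _∧_; _∨_; T)
open import Data.Bool.ListAction using (all)
open import Data.Bool.Properties using (⇔→≡; ∧-zeroʳ; T-≡)
open import Data.Empty using (⊥-elim)
open import Data.Fin as Fin using (Fin; zero; suc; toℕ; _↑ˡ_; _↑ʳ_; splitAt)
open import Data.Fin.Permutation as Perm using (Permutation; _⟨$⟩ʳ_; _⟨$⟩ˡ_; _∘ₚ_)
import Data.Fin.Permutation.Components as PermC
open import Data.Fin.Properties
  using (+↔⊎; toℕ-↑ˡ; toℕ-↑ʳ; toℕ-cast; toℕ<n; splitAt-↑ˡ; splitAt-↑ʳ; splitAt⁻¹-↑ˡ; splitAt⁻¹-↑ʳ)
open import Data.Fin.Subset using (Subset; _∈_; _∉_; _⊆_; _⊂_; _∪_; _∩_; _─_; ⁅_⁆; ∣_∣; Empty)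
open import Data.Fin.Subset.Induction using (⊂-wellFounded)
open import Data.Fin.Subset.Properties
  using (⊆-antisym; ∪⇔⊎; ∩⇔×; x∈p∩q⁺; x∈p∪q⁺; x∈p∪q⁻; p⊆p∪q; x∈⁅x⁆; x∈⁅y⁆⇒x≡y; x∈⁅y⁆⇔x≡y;
         p─q⊆p; x∈p∧x∉q⇒x∈p─q; x∈p∧x≢y⇒x∈p-y; nonempty?; x∈p⇒p-x⊂p)
open import Data.List as List using (List; []; _∷_; [_])
open import Data.List.Membership.Propositional using () renaming (_∈_ to _∈ₗ_)
open import Data.List.Membership.Propositional.Properties using (∈-∃++)
open import Data.List.Relation.Binary.Permutation.Propositional as ↭
  using (_↭_; prep; ↭-refl; ↭-sym; ↭-trans)
open import Data.List.Relation.Binary.Permutation.Propositional.Properties using (map⁺; shift)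
open import Data.List.Relation.Unary.All.Properties using (all⁺; all⁻; tabulate⁺; tabulate⁻)
open import Data.List.Relation.Unary.Any using () renaming (here to hereₗ; there to thereₗ)
open import Data.Nat using (ℕ; zero; suc; _+_; _*_; _≤_; _<_; s≤s; z≤n; ∣_-_∣; _≡ᵇ_)
open import Data.Nat.ListAction using (sum)
open import Data.Nat.ListAction.Properties using (sum-↭)
open import Data.Nat.Properties
  using (∣-∣-comm; ∣m+n-m+o∣≡∣n-o∣; +-assoc; +-comm; +-suc; +-identityʳ; +-cancelˡ-≡; +-cancelʳ-≡;
         *-zeroʳ; *-identityʳ; *-distribˡ-+; *-cancelˡ-≡; m+1+n≰m; m+n≮m; n<1+n; <-trans; ≡ᵇ⇒≡;
         +-0-commutativeMonoid)
open import Algebra.Properties.CommutativeMonoid.Sum +-0-commutativeMonoid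
  using (sum-syntax; ∑-permute; sum-cong-≗; sum-replicate-zero)
open import Data.Product using (_×_; _,_; proj₁; proj₂)
open import Data.Product.Function.NonDependent.Propositional using (_×-⇔_)
open import Data.Sum as Sum using (_⊎_; inj₁; inj₂)
open import Data.Sum.Algebra using (⊎-comm)
open import Data.Sum.Function.Propositional using (_⊎-↔_; _⊎-⇔_)
open import Data.Vec using (Vec; []; _∷_; here; there; lookup; _++_; replicate; cast; toList; tabulate)
open import Data.Vec.Properties
  using (lookup-++ˡ; lookup-++ʳ; lookup-cast; ++-assoc-eqFree; lookup-replicate; lookup∘tabulate;
         []=⇒lookup; lookup⇒[]=)
open import Function using (_∘_; _⇔_; mk⇔; Equivalence; case_of_)
open Equivalence using (to; from)
open import Function.Properties.Inverse using (↔-trans; ↔-sym)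
import Function.Properties.Equivalence as ⇔
open import Function.Related.TypeIsomorphisms using (→-cong-⇔; ¬-cong-⇔)
open import Induction.WellFounded using (WfRec; module All)
open import Level using (0ℓ)
open import Relation.Binary.Construct.Closure.ReflexiveTransitive using (Star; ε; _◅_; gmap; reverse)
open import Relation.Binary.PropositionalEquality hiding ([_])
open import Relation.Nullary using (¬_; yes; no)
open import Relation.Nullary.Decidable using (dec-true)

private
  variable
    a a' b b' c m : ℕ

∣m-n∣≡1⇒1+m≡n⊎1+n≡m : ∀ {m n} → ∣ m - n ∣ ≡ 1 → suc m ≡ n ⊎ suc n ≡ m
∣m-n∣≡1⇒1+m≡n⊎1+n≡m {zero}        {suc zero}    _ = inj₁ refl
∣m-n∣≡1⇒1+m≡n⊎1+n≡m {suc zero}    {zero}        _ = inj₂ refl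
∣m-n∣≡1⇒1+m≡n⊎1+n≡m {suc m}       {suc n}       d = Sum.map (cong suc) (cong suc) (∣m-n∣≡1⇒1+m≡n⊎1+n≡m d)
∣m-n∣≡1⇒1+m≡n⊎1+n≡m {zero}        {zero}        ()
∣m-n∣≡1⇒1+m≡n⊎1+n≡m {zero}        {suc (suc n)} ()
∣m-n∣≡1⇒1+m≡n⊎1+n≡m {suc (suc m)} {zero}        ()

⇔-⊥ : ∀ {A B : Set} → ¬ A → ¬ B → A ⇔ B
⇔-⊥ ¬A ¬B = mk⇔ (⊥-elim ∘ ¬A) (⊥-elim ∘ ¬B)

-- Subsets as induced subgraphs of the path 0 — 1 — ⋯ — (m - 1)

record Edge (x : Vec Bool m) (i j : Fin m) : Set where
  constructor edge
  field
    memberˡ  : lookup x i ≡ true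
    memberʳ  : lookup x j ≡ true
    adjacent : Adjacent i j

edge-sym : ∀ {x : Vec Bool m} {i j} → Edge x i j → Edge x j i
edge-sym {i = i} {j} (edge xi xj adj) = edge xj xi (trans (∣-∣-comm (toℕ j) (toℕ i)) adj)

edge-cong : ∀ {x : Vec Bool a} {y : Vec Bool b} {i j k l} →
            lookup x i ≡ lookup y k → lookup x j ≡ lookup y l →
            ∣ toℕ i - toℕ j ∣ ≡ ∣ toℕ k - toℕ l ∣ → Edge x i j ⇔ Edge y k l
edge-cong xi≡yk xj≡yl d = mk⇔
  (λ (edge xi xj adj) → edge (trans (sym xi≡yk) xi) (trans (sym xj≡yl) xj) (trans (sym d) adj))
  (λ (edge yk yl adj) → edge (trans xi≡yk yk) (trans xj≡yl yl) (trans d adj))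

edge-suc : ∀ {x : Vec Bool m} {c i j} → Edge (c ∷ x) (suc i) (suc j) ⇔ Edge x i j
edge-suc = mk⇔ (λ (edge p q r) → edge p q r) (λ (edge p q r) → edge p q r)

module _ (x : Vec Bool a) (y : Vec Bool b) where

  edge-↑ˡ : ∀ i j → Edge x i j ⇔ Edge (x ++ y) (i ↑ˡ b) (j ↑ˡ b)
  edge-↑ˡ i j = edge-cong (sym (lookup-++ˡ x y i)) (sym (lookup-++ˡ x y j))
    (sym (cong₂ ∣_-_∣ (toℕ-↑ˡ i b) (toℕ-↑ˡ j b)))

  edge-↑ʳ : ∀ i j → Edge y i j ⇔ Edge (x ++ y) (a ↑ʳ i) (a ↑ʳ j)
  edge-↑ʳ i j = edge-cong (sym (lookup-++ʳ x y i)) (sym (lookup-++ʳ x y j))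
    (sym (trans (cong₂ ∣_-_∣ (toℕ-↑ʳ a i) (toℕ-↑ʳ a j)) (∣m+n-m+o∣≡∣n-o∣ a (toℕ i) (toℕ j))))

data StartsOutside : Vec Bool b → Set where
  []     : StartsOutside []
  false∷ : ∀ {y : Vec Bool b} → StartsOutside (false ∷ y)

no-edge-across : (x : Vec Bool a) {y : Vec Bool b} → StartsOutside y →
                 ∀ i j → ¬ Edge (x ++ y) (i ↑ˡ b) (a ↑ʳ j)
no-edge-across x {false ∷ y} false∷ i zero (edge _ y₀ _) with () ← trans (sym (lookup-++ʳ x (false ∷ y) zero)) y₀
no-edge-across {a} x false∷ i (suc j) (edge _ _ adj)
  with ∣m-n∣≡1⇒1+m≡n⊎1+n≡m (subst₂ (λ p q → ∣ p - q ∣ ≡ 1) (toℕ-↑ˡ i _) (toℕ-↑ʳ a (suc j)) adj)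
... | inj₁ eq = m+1+n≰m a (subst (_≤ a) eq (toℕ<n i))
... | inj₂ eq = m+n≮m a (suc (toℕ j)) (<-trans (n<1+n _) (subst (_< a) (sym eq) (toℕ<n i)))

data SplitView (a b : ℕ) : Fin (a + b) → Set where
  left  : (i : Fin a) → SplitView a b (i ↑ˡ b)
  right : (j : Fin b) → SplitView a b (a ↑ʳ j)

splitView : ∀ a b (k : Fin (a + b)) → SplitView a b k
splitView a b k with splitAt a k in eq
... | inj₁ i = subst (SplitView a b) (splitAt⁻¹-↑ˡ eq) (left i)
... | inj₂ j = subst (SplitView a b) (splitAt⁻¹-↑ʳ eq) (right j)

record _≅_ (x : Vec Bool a) (y : Vec Bool b) : Set where
  field
    σ        : Permutation a b
    lookup-σ : ∀ i → lookup x i ≡ lookup y (σ ⟨$⟩ʳ i)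
    edge-σ   : ∀ i j → Edge x i j ⇔ Edge y (σ ⟨$⟩ʳ i) (σ ⟨$⟩ʳ j)
open _≅_

infix 4 _≅_

≅-refl : ∀ {x : Vec Bool a} → x ≅ x
≅-refl = record { σ = Perm.id ; lookup-σ = λ _ → refl ; edge-σ = λ _ _ → ⇔.refl }

≡⇒≅ : ∀ {x y : Vec Bool a} → x ≡ y → x ≅ y
≡⇒≅ refl = ≅-refl

≅-sym : ∀ {x : Vec Bool a} {y : Vec Bool b} → x ≅ y → y ≅ x
≅-sym {x = x} {y} ρ = record
  { σ        = Perm.flip (σ ρ)
  ; lookup-σ = λ j → sym (trans (lookup-σ ρ (ρ⁻¹ j)) (cong (lookup y) (Perm.inverseʳ (σ ρ))))
  ; edge-σ   = λ i j → ⇔.sym (subst₂ (λ k l → Edge x (ρ⁻¹ i) (ρ⁻¹ j) ⇔ Edge y k l)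
                         (Perm.inverseʳ (σ ρ)) (Perm.inverseʳ (σ ρ)) (edge-σ ρ (ρ⁻¹ i) (ρ⁻¹ j)))
  }
  where ρ⁻¹ = σ ρ ⟨$⟩ˡ_

≅-trans : ∀ {x : Vec Bool a} {y : Vec Bool b} {z : Vec Bool c} → x ≅ y → y ≅ z → x ≅ z
≅-trans ρ τ = record
  { σ        = σ ρ ∘ₚ σ τ
  ; lookup-σ = λ i → trans (lookup-σ ρ i) (lookup-σ τ _)
  ; edge-σ   = λ i j → ⇔.trans (edge-σ ρ i j) (edge-σ τ _ _)
  }

_⊕ₚ_ : Permutation a a' → Permutation b b' → Permutation (a + b) (a' + b')
ρ ⊕ₚ τ = ↔-trans +↔⊎ (↔-trans (ρ ⊎-↔ τ) (↔-sym +↔⊎))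

⊕ₚ-↑ˡ : (ρ : Permutation a a') (τ : Permutation b b') (i : Fin a) →
        (ρ ⊕ₚ τ) ⟨$⟩ʳ (i ↑ˡ b) ≡ (ρ ⟨$⟩ʳ i) ↑ˡ b'
⊕ₚ-↑ˡ {a} {b = b} ρ τ i rewrite splitAt-↑ˡ a i b = refl

⊕ₚ-↑ʳ : (ρ : Permutation a a') (τ : Permutation b b') (j : Fin b) →
        (ρ ⊕ₚ τ) ⟨$⟩ʳ (a ↑ʳ j) ≡ a' ↑ʳ (τ ⟨$⟩ʳ j)
⊕ₚ-↑ʳ {a} {b = b} ρ τ j rewrite splitAt-↑ʳ a b j = refl

swapₚ : ∀ a b → Permutation (a + b) (b + a)
swapₚ a b = ↔-trans (+↔⊎ {a} {b}) (↔-trans (⊎-comm _ _) (↔-sym +↔⊎))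

swapₚ-↑ˡ : (i : Fin a) → swapₚ a b ⟨$⟩ʳ (i ↑ˡ b) ≡ b ↑ʳ i
swapₚ-↑ˡ {a} {b} i rewrite splitAt-↑ˡ a i b = refl

swapₚ-↑ʳ : (j : Fin b) → swapₚ a b ⟨$⟩ʳ (a ↑ʳ j) ≡ j ↑ˡ a
swapₚ-↑ʳ {b} {a} j rewrite splitAt-↑ʳ a b j = refl

++-cong-≅ : ∀ {x : Vec Bool a} {x' : Vec Bool a'} {y : Vec Bool b} {y' : Vec Bool b'} →
            StartsOutside y → StartsOutside y' → x ≅ x' → y ≅ y' → x ++ y ≅ x' ++ y'
++-cong-≅ {a} {a'} {b} {b'} {x} {x'} {y} {y'} y₀ y₀' ρ τ = record
  { σ        = π
  ; lookup-σ = λ k → lookup-π (splitView a b k)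
  ; edge-σ   = λ k l → edge-π (splitView a b k) (splitView a b l)
  }
  where
  π = σ ρ ⊕ₚ σ τ

  lookup-π : ∀ {k} → SplitView a b k → lookup (x ++ y) k ≡ lookup (x' ++ y') (π ⟨$⟩ʳ k)
  lookup-π (left i) rewrite ⊕ₚ-↑ˡ (σ ρ) (σ τ) i =
    trans (lookup-++ˡ x y i) (trans (lookup-σ ρ i) (sym (lookup-++ˡ x' y' _)))
  lookup-π (right j) rewrite ⊕ₚ-↑ʳ (σ ρ) (σ τ) j =
    trans (lookup-++ʳ x y j) (trans (lookup-σ τ j) (sym (lookup-++ʳ x' y' _)))

  edge-π : ∀ {k l} → SplitView a b k → SplitView a b l →
           Edge (x ++ y) k l ⇔ Edge (x' ++ y') (π ⟨$⟩ʳ k) (π ⟨$⟩ʳ l)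
  edge-π (left i) (left j) rewrite ⊕ₚ-↑ˡ (σ ρ) (σ τ) i | ⊕ₚ-↑ˡ (σ ρ) (σ τ) j =
    ⇔.trans (⇔.sym (edge-↑ˡ x y i j)) (⇔.trans (edge-σ ρ i j) (edge-↑ˡ x' y' _ _))
  edge-π (right i) (right j) rewrite ⊕ₚ-↑ʳ (σ ρ) (σ τ) i | ⊕ₚ-↑ʳ (σ ρ) (σ τ) j =
    ⇔.trans (⇔.sym (edge-↑ʳ x y i j)) (⇔.trans (edge-σ τ i j) (edge-↑ʳ x' y' _ _))
  edge-π (left i) (right j) rewrite ⊕ₚ-↑ˡ (σ ρ) (σ τ) i | ⊕ₚ-↑ʳ (σ ρ) (σ τ) j =
    ⇔-⊥ (no-edge-across x y₀ i j) (no-edge-across x' y₀' _ _)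
  edge-π (right i) (left j) rewrite ⊕ₚ-↑ʳ (σ ρ) (σ τ) i | ⊕ₚ-↑ˡ (σ ρ) (σ τ) j =
    ⇔-⊥ (no-edge-across x y₀ j i ∘ edge-sym) (no-edge-across x' y₀' _ _ ∘ edge-sym)

++-comm-≅ : ∀ {x : Vec Bool a} {y : Vec Bool b} → StartsOutside x → StartsOutside y → x ++ y ≅ y ++ x
++-comm-≅ {a} {b} {x} {y} x₀ y₀ = record
  { σ        = swapₚ a b
  ; lookup-σ = λ k → lookup-π (splitView a b k)
  ; edge-σ   = λ k l → edge-π (splitView a b k) (splitView a b l)
  }
  where
  π = swapₚ a b

  lookup-π : ∀ {k} → SplitView a b k → lookup (x ++ y) k ≡ lookup (y ++ x) (π ⟨$⟩ʳ k)
  lookup-π (left i) rewrite swapₚ-↑ˡ {a} {b} i = trans (lookup-++ˡ x y i) (sym (lookup-++ʳ y x i))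
  lookup-π (right j) rewrite swapₚ-↑ʳ {b} {a} j = trans (lookup-++ʳ x y j) (sym (lookup-++ˡ y x j))

  edge-π : ∀ {k l} → SplitView a b k → SplitView a b l →
           Edge (x ++ y) k l ⇔ Edge (y ++ x) (π ⟨$⟩ʳ k) (π ⟨$⟩ʳ l)
  edge-π (left i) (left j) rewrite swapₚ-↑ˡ {a} {b} i | swapₚ-↑ˡ {a} {b} j =
    ⇔.trans (⇔.sym (edge-↑ˡ x y i j)) (edge-↑ʳ y x i j)
  edge-π (right i) (right j) rewrite swapₚ-↑ʳ {b} {a} i | swapₚ-↑ʳ {b} {a} j =
    ⇔.trans (⇔.sym (edge-↑ʳ x y i j)) (edge-↑ˡ y x i j)
  edge-π (left i) (right j) rewrite swapₚ-↑ˡ {a} {b} i | swapₚ-↑ʳ {b} {a} j =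
    ⇔-⊥ (no-edge-across x y₀ i j) (no-edge-across y x₀ j i ∘ edge-sym)
  edge-π (right i) (left j) rewrite swapₚ-↑ʳ {b} {a} i | swapₚ-↑ˡ {a} {b} j =
    ⇔-⊥ (no-edge-across x y₀ j i ∘ edge-sym) (no-edge-across y x₀ i j)

cast-≅ : (eq : a ≡ b) (x : Vec Bool a) → x ≅ cast eq x
cast-≅ eq x = record
  { σ        = Perm.cast-id eq
  ; lookup-σ = λ i → sym (lookup-cast eq x i)
  ; edge-σ   = λ i j → edge-cong (sym (lookup-cast eq x i)) (sym (lookup-cast eq x j))
                         (sym (cong₂ ∣_-_∣ (toℕ-cast eq i) (toℕ-cast eq j)))
  }

++-assoc-≅ : (x : Vec Bool a) (y : Vec Bool b) (z : Vec Bool c) → (x ++ y) ++ z ≅ x ++ (y ++ z)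
++-assoc-≅ {a} {b} {c} x y z = ≅-trans (cast-≅ (+-assoc a b c) _) (≡⇒≅ (++-assoc-eqFree x y z))

fixing-members-≅ : ∀ {x : Vec Bool m} (π : Permutation m m) →
                   (∀ i → lookup x i ≡ lookup x (π ⟨$⟩ʳ i)) →
                   (∀ i → lookup x i ≡ true → π ⟨$⟩ʳ i ≡ i) → x ≅ x
fixing-members-≅ {x = x} π lookup-π fix = record
  { σ        = π
  ; lookup-σ = lookup-π
  ; edge-σ   = λ i j → mk⇔
      (λ e@(edge xi xj _) → subst₂ (Edge x) (sym (fix i xi)) (sym (fix j xj)) e)
      (λ e@(edge xπi xπj _) → subst₂ (Edge x) (fix i (trans (lookup-π i) xπi)) (fix j (trans (lookup-π j) xπj)) e)
  }

transpose-≅ : ∀ {x : Vec Bool m} {p q} → lookup x p ≡ false → lookup x q ≡ false → x ≅ x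
transpose-≅ {x = x} {p} {q} xp xq = fixing-members-≅ (Perm.transpose p q) lookup-τ fix
  where
  lookup-τ : ∀ k → lookup x k ≡ lookup x (PermC.transpose p q k)
  lookup-τ k with k Fin.≟ p
  ... | yes refl = trans xp (sym xq)
  ... | no _ with k Fin.≟ q
  ...   | yes refl = trans xq (sym xp)
  ...   | no _ = refl
  fix : ∀ k → lookup x k ≡ true → PermC.transpose p q k ≡ k
  fix k xk with k Fin.≟ p
  ... | yes refl with () ← trans (sym xk) xp
  ... | no _ with k Fin.≟ q
  ...   | yes refl with () ← trans (sym xk) xq
  ...   | no _ = refl

transpose-self : (p q : Fin m) → PermC.transpose p q p ≡ q
transpose-self p q rewrite dec-true (p Fin.≟ p) refl = refl

≅-remove-zero : ∀ {x y : Vec Bool m} (ρ : false ∷ x ≅ false ∷ y) → σ ρ ⟨$⟩ʳ zero ≡ zero → x ≅ y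
≅-remove-zero {x = x} {y} ρ ρ₀≡0 = record
  { σ        = π
  ; lookup-σ = λ i → trans (lookup-σ ρ (suc i)) (cong (lookup (false ∷ y)) (ρ-suc i))
  ; edge-σ   = λ i j → ⇔.trans (⇔.sym edge-suc) (⇔.trans (edge-σ ρ (suc i) (suc j))
                         (subst₂ (λ k l → Edge (false ∷ y) k l ⇔ Edge y (π ⟨$⟩ʳ i) (π ⟨$⟩ʳ j))
                            (sym (ρ-suc i)) (sym (ρ-suc j)) edge-suc))
  }
  where
  π = Perm.remove zero (σ ρ)
  ρ-suc : ∀ i → σ ρ ⟨$⟩ʳ suc i ≡ suc (π ⟨$⟩ʳ i)
  ρ-suc i = trans (Perm.punchIn-permute (σ ρ) zero i) (cong (λ p → Fin.punchIn p (π ⟨$⟩ʳ i)) ρ₀≡0)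

-- Transposing σ(0) with 0, both non-members, makes σ fix 0, which can then be removed.
false∷-cancel-≅ : ∀ {x y : Vec Bool m} → false ∷ x ≅ false ∷ y → x ≅ y
false∷-cancel-≅ {y = y} ρ = ≅-remove-zero (≅-trans ρ τ) (transpose-self (σ ρ ⟨$⟩ʳ zero) zero)
  where τ = transpose-≅ {x = false ∷ y} (sym (lookup-σ ρ zero)) refl

-- Multisets of run lengths

bit : Bool → ℕ
bit true  = 1
bit false = 0

multiplicity : ℕ → List ℕ → ℕ
multiplicity v ks = sum (List.map (λ k → bit (k ≡ᵇ v)) ks)

multiplicity-↭ : ∀ v {ks ls} → ks ↭ ls → multiplicity v ks ≡ multiplicity v ls
multiplicity-↭ v ks↭ls = sum-↭ (map⁺ _ ks↭ls)

bit-≡ᵇ-refl : ∀ n → bit (n ≡ᵇ n) ≡ 1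
bit-≡ᵇ-refl zero    = refl
bit-≡ᵇ-refl (suc n) = bit-≡ᵇ-refl n

multiplicity-head : ∀ k ks → 0 < multiplicity k (k ∷ ks)
multiplicity-head k ks = subst (λ n → 0 < n + multiplicity k ks) (sym (bit-≡ᵇ-refl k)) (s≤s z≤n)

multiplicity>0⇒∈ : ∀ v ks → 0 < multiplicity v ks → v ∈ₗ ks
multiplicity>0⇒∈ v (k ∷ ks) pos with k ≡ᵇ v in k≡ᵇv
... | true  = hereₗ (sym (≡ᵇ⇒≡ k v (subst T (sym k≡ᵇv) _)))
... | false = thereₗ (multiplicity>0⇒∈ v ks pos)

multiplicities⇒↭ : ∀ ks ls → (∀ v → multiplicity v ks ≡ multiplicity v ls) → ks ↭ ls
multiplicities⇒↭ [] [] _ = ↭-refl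
multiplicities⇒↭ [] (l ∷ ls) same with () ← subst (0 <_) (sym (same l)) (multiplicity-head l ls)
multiplicities⇒↭ (k ∷ ks) ls same
  with as , bs , refl ← ∈-∃++ (multiplicity>0⇒∈ k ls (subst (0 <_) (same k) (multiplicity-head k ks)))
  = ↭-trans (prep k (multiplicities⇒↭ ks (as List.++ bs) same′)) (↭-sym (shift k as bs))
  where
  same′ : ∀ v → multiplicity v ks ≡ multiplicity v (as List.++ bs)
  same′ v = +-cancelˡ-≡ (bit (k ≡ᵇ v)) _ _ (trans (same v) (multiplicity-↭ v (shift k as bs)))

weight : List ℕ → ℕ
weight ks = sum (List.map suc ks)

weight-↭ : ∀ {ks ls} → ks ↭ ls → weight ks ≡ weight ls
weight-↭ ks↭ls = sum-↭ (map⁺ suc ks↭ls)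

positives : List ℕ → List ℕ
positives []           = []
positives (zero  ∷ ks) = positives ks
positives (suc k ∷ ks) = suc k ∷ positives ks

multiplicity-positives : ∀ v ks → multiplicity (suc v) (positives ks) ≡ multiplicity (suc v) ks
multiplicity-positives v []           = refl
multiplicity-positives v (zero  ∷ ks) = multiplicity-positives v ks
multiplicity-positives v (suc k ∷ ks) = cong (bit (k ≡ᵇ v) +_) (multiplicity-positives v ks)

multiplicity-zero-positives : ∀ ks → multiplicity 0 (positives ks) ≡ 0
multiplicity-zero-positives []           = refl
multiplicity-zero-positives (zero  ∷ ks) = multiplicity-zero-positives ks
multiplicity-zero-positives (suc k ∷ ks) = multiplicity-zero-positives ks

weight-positives : ∀ ks → weight ks ≡ multiplicity 0 ks + weight (positives ks)
weight-positives []           = refl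
weight-positives (zero  ∷ ks) = cong suc (weight-positives ks)
weight-positives (suc k ∷ ks) = begin
  2+k + weight ks                                   ≡⟨ cong (2+k +_) (weight-positives ks) ⟩
  2+k + (multiplicity 0 ks + weight (positives ks)) ≡⟨ +-assoc 2+k _ _ ⟨
  2+k + multiplicity 0 ks + weight (positives ks)   ≡⟨ cong (_+ weight (positives ks)) (+-comm 2+k _) ⟩
  multiplicity 0 ks + 2+k + weight (positives ks)   ≡⟨ +-assoc (multiplicity 0 ks) _ _ ⟩
  multiplicity 0 ks + weight (positives (suc k ∷ ks)) ∎
  where
  open ≡-Reasoning
  2+k = suc (suc k)

positives-↭ : ∀ ks ls → (∀ v → multiplicity (suc v) ks ≡ multiplicity (suc v) ls) →
              positives ks ↭ positives ls
positives-↭ ks ls same = multiplicities⇒↭ _ _ λ where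
  zero    → trans (multiplicity-zero-positives ks) (sym (multiplicity-zero-positives ls))
  (suc v) → trans (multiplicity-positives v ks) (trans (same v) (sym (multiplicity-positives v ls)))

-- The zero entries are recovered from the total weight.
↭-from-positives : ∀ ks ls → weight ks ≡ weight ls → positives ks ↭ positives ls → ks ↭ ls
↭-from-positives ks ls w p = multiplicities⇒↭ ks ls λ where
    zero    → +-cancelʳ-≡ _ _ _ (begin
      multiplicity 0 ks + weight (positives ks) ≡⟨ weight-positives ks ⟨
      weight ks                                 ≡⟨ w ⟩
      weight ls                                 ≡⟨ weight-positives ls ⟩
      multiplicity 0 ls + weight (positives ls) ≡⟨ cong (multiplicity 0 ls +_) (weight-↭ p) ⟨
      multiplicity 0 ls + weight (positives ks) ∎)
    (suc v) → trans (sym (multiplicity-positives v ks))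
                (trans (multiplicity-↭ (suc v) p) (multiplicity-positives v ls))
  where open ≡-Reasoning

-- Decomposition into blocks false ∷ trueᵏ

block : ∀ k → Vec Bool (suc k)
block k = false ∷ replicate k true

blocks : (ks : List ℕ) → Vec Bool (weight ks)
blocks []       = []
blocks (k ∷ ks) = block k ++ blocks ks

blocks-startsOutside : ∀ ks → StartsOutside (blocks ks)
blocks-startsOutside []       = []
blocks-startsOutside (k ∷ ks) = false∷

↭⇒blocks-≅ : ∀ {ks ls} → ks ↭ ls → blocks ks ≅ blocks ls
↭⇒blocks-≅ ↭.refl = ≅-refl
↭⇒blocks-≅ (↭.prep {ks} {ls} k p) =
  ++-cong-≅ (blocks-startsOutside ks) (blocks-startsOutside ls) ≅-refl (↭⇒blocks-≅ p)
↭⇒blocks-≅ (↭.swap {ks} {ls} k l p) = ≅-trans (≅-sym (++-assoc-≅ (block k) (block l) (blocks ks)))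
  (≅-trans (++-cong-≅ (blocks-startsOutside ks) (blocks-startsOutside ls) (++-comm-≅ false∷ false∷) (↭⇒blocks-≅ p))
           (++-assoc-≅ (block l) (block k) (blocks ls)))
↭⇒blocks-≅ (↭.trans p q) = ≅-trans (↭⇒blocks-≅ p) (↭⇒blocks-≅ q)

-- The `++ []` makes false ∷ x definitionally equal to blocks (blockLengths v).
data RunView : Vec Bool m → Set where
  final : ∀ k → RunView (replicate k true ++ [])
  _∷_   : ∀ k {r : Vec Bool m} → RunView r → RunView (replicate k true ++ false ∷ r)

runView : (x : Vec Bool m) → RunView x
runView []          = final 0
runView (false ∷ x) = 0 ∷ runView x
runView (true ∷ x) with runView x
... | final k = final (suc k)
... | k ∷ v   = suc k ∷ v

blockLengths : ∀ {x : Vec Bool m} → RunView x → List ℕ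
blockLengths (final k) = [ k ]
blockLengths (k ∷ v)   = k ∷ blockLengths v

false∷-≅-blocks : ∀ {x : Vec Bool m} (v : RunView x) → false ∷ x ≅ blocks (blockLengths v)
false∷-≅-blocks (final k) = ≅-refl
false∷-≅-blocks (k ∷ v)   =
  ++-cong-≅ false∷ (blocks-startsOutside (blockLengths v)) ≅-refl (false∷-≅-blocks v)

runsFrom-replicate : ∀ k j (r : Vec Bool m) →
                     runsFrom j (toList (replicate k true ++ r)) ≡ runsFrom (k + j) (toList r)
runsFrom-replicate zero    j r = refl
runsFrom-replicate (suc k) j r =
  trans (runsFrom-replicate k (suc j) r) (cong (λ n → runsFrom n (toList r)) (+-suc k j))

flush≡positives : ∀ k → flush k ≡ positives [ k ]
flush≡positives zero    = refl
flush≡positives (suc k) = refl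

positives-∷ : ∀ k ks → positives (k ∷ ks) ≡ flush k List.++ positives ks
positives-∷ zero    ks = refl
positives-∷ (suc k) ks = refl

runLengths-view : ∀ {x : Vec Bool m} (v : RunView x) → runLengths x ≡ positives (blockLengths v)
runLengths-view (final k) = begin
  runLengths (replicate k true ++ []) ≡⟨ runsFrom-replicate k 0 [] ⟩
  flush (k + 0)                       ≡⟨ cong flush (+-identityʳ k) ⟩
  flush k                             ≡⟨ flush≡positives k ⟩
  positives [ k ]                     ∎
  where open ≡-Reasoning
runLengths-view {x = .(replicate k true ++ false ∷ r)} (_∷_ k {r} v) = begin
  runLengths (replicate k true ++ false ∷ r)       ≡⟨ runsFrom-replicate k 0 (false ∷ r) ⟩
  flush (k + 0) List.++ runLengths r
    ≡⟨ cong₂ List._++_ (cong flush (+-identityʳ k)) (runLengths-view v) ⟩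
  flush k List.++ positives (blockLengths v)       ≡⟨ positives-∷ k (blockLengths v) ⟨
  positives (k ∷ blockLengths v)                   ∎
  where open ≡-Reasoning

runLengths-↭⇒≅ : ∀ {x y : Vec Bool m} → runLengths x ↭ runLengths y → x ≅ y
runLengths-↭⇒≅ {x = x} {y} runs↭ =
  false∷-cancel-≅ (≅-trans ρx (≅-trans (↭⇒blocks-≅ blocks↭) (≅-sym ρy)))
  where
  ρx = false∷-≅-blocks (runView x)
  ρy = false∷-≅-blocks (runView y)
  blocks↭ : blockLengths (runView x) ↭ blockLengths (runView y)
  blocks↭ = ↭-from-positives _ _ (trans (sym (Perm.↔⇒≡ (σ ρx))) (Perm.↔⇒≡ (σ ρy)))
              (subst₂ _↭_ (runLengths-view (runView x)) (runLengths-view (runView y)) runs↭)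

-- Run sizes

allUpTo : Vec Bool m → Fin m → Bool
allUpTo (b ∷ x) zero    = b
allUpTo (b ∷ x) (suc j) = b ∧ allUpTo x j

-- sameRun x i j: all positions from i to j (inclusive) are members of x.
sameRun : Vec Bool m → Fin m → Fin m → Bool
sameRun x       zero    j       = allUpTo x j
sameRun x       (suc i) zero    = allUpTo x (suc i)
sameRun (_ ∷ x) (suc i) (suc j) = sameRun x i j

sameRun-refl : ∀ (x : Vec Bool m) i → sameRun x i i ≡ lookup x i
sameRun-refl (b ∷ x) zero    = refl
sameRun-refl (b ∷ x) (suc i) = sameRun-refl x i

sameRun-sym : ∀ (x : Vec Bool m) i j → sameRun x i j ≡ sameRun x j i
sameRun-sym x       zero    zero    = refl
sameRun-sym x       zero    (suc j) = refl
sameRun-sym x       (suc i) zero    = refl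
sameRun-sym (b ∷ x) (suc i) (suc j) = sameRun-sym x i j

allUpTo-sameRun : ∀ (x : Vec Bool m) i j → allUpTo x i ≡ true → sameRun x i j ≡ true → allUpTo x j ≡ true
allUpTo-sameRun x           zero    j       _  s = s
allUpTo-sameRun (true ∷ x)  (suc i) zero    _  _ = refl
allUpTo-sameRun (true ∷ x)  (suc i) (suc j) a  s = allUpTo-sameRun x i j a s
allUpTo-sameRun (false ∷ x) (suc i) j       () _

allUpTo⇒sameRun : ∀ (x : Vec Bool m) i j → allUpTo x i ≡ true → allUpTo x j ≡ true → sameRun x i j ≡ true
allUpTo⇒sameRun x           zero    j       _  aj = aj
allUpTo⇒sameRun x           (suc i) zero    ai _  = ai
allUpTo⇒sameRun (true ∷ x)  (suc i) (suc j) ai aj = allUpTo⇒sameRun x i j ai aj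
allUpTo⇒sameRun (false ∷ x) (suc i) (suc j) () _

sameRun-trans : ∀ (x : Vec Bool m) i j k → sameRun x i j ≡ true → sameRun x j k ≡ true → sameRun x i k ≡ true
sameRun-trans x           zero    j       k       s t = allUpTo-sameRun x j k s t
sameRun-trans x           (suc i) zero    k       s t = allUpTo⇒sameRun x (suc i) k s t
sameRun-trans (true ∷ x)  (suc i) (suc j) zero    s t =
  allUpTo-sameRun x j i t (trans (sameRun-sym x j i) s)
sameRun-trans (false ∷ x) (suc i) (suc j) zero    s ()
sameRun-trans (b ∷ x)     (suc i) (suc j) (suc k) s t = sameRun-trans x i j k s t

edge⇒sameRun : ∀ {x : Vec Bool m} {i j} → Edge x i j → sameRun x i j ≡ true
edge⇒sameRun {x = true ∷ c ∷ x} {zero}       {suc zero} (edge _ x₁ _) = x₁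
edge⇒sameRun {x = true ∷ c ∷ x} {suc zero}   {zero}     (edge x₁ _ _) = x₁
edge⇒sameRun {x = false ∷ x}    {zero}       {suc j}    (edge () _ _)
edge⇒sameRun {x = false ∷ x}    {suc i}      {zero}     (edge _ () _)
edge⇒sameRun {x = b ∷ x}        {suc i}      {suc j}    e = edge⇒sameRun {x = x} (to edge-suc e)
edge⇒sameRun                    {i = zero}   {zero}     (edge _ _ ())
edge⇒sameRun {x = true ∷ x}     {zero}       {suc (suc j)} (edge _ _ ())
edge⇒sameRun {x = true ∷ x}     {suc (suc i)} {zero}    (edge _ _ ())

shift-path : ∀ {x : Vec Bool m} {b i j} → Star (Edge x) i j → Star (Edge (b ∷ x)) (suc i) (suc j)
shift-path = gmap suc (from edge-suc)

allUpTo⇒head : ∀ (x : Vec Bool (suc m)) j → allUpTo x j ≡ true → lookup x zero ≡ true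
allUpTo⇒head (b ∷ x)     zero    a  = a
allUpTo⇒head (true ∷ x)  (suc j) _  = refl
allUpTo⇒head (false ∷ x) (suc j) ()

allUpTo⇒path : ∀ (x : Vec Bool (suc m)) j → allUpTo x j ≡ true → Star (Edge x) zero j
allUpTo⇒path (b ∷ x)         zero    _  = ε
allUpTo⇒path (true ∷ c ∷ x)  (suc j) a  =
  edge refl (allUpTo⇒head (c ∷ x) j a) refl ◅ shift-path (allUpTo⇒path (c ∷ x) j a)
allUpTo⇒path (false ∷ x)     (suc j) ()

sameRun⇒path : ∀ (x : Vec Bool m) i j → sameRun x i j ≡ true → Star (Edge x) i j
sameRun⇒path x       zero    j       s = allUpTo⇒path x j s
sameRun⇒path x       (suc i) zero    s = reverse edge-sym (allUpTo⇒path x (suc i) s)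
sameRun⇒path (b ∷ x) (suc i) (suc j) s = shift-path (sameRun⇒path x i j s)

path⇒sameRun : ∀ {x : Vec Bool m} {i j} → lookup x i ≡ true → Star (Edge x) i j → sameRun x i j ≡ true
path⇒sameRun {x = x} {i} xi ε = trans (sameRun-refl x i) xi
path⇒sameRun {x = x} {i} _ (_◅_ {j = k} e p) =
  sameRun-trans x i k _ (edge⇒sameRun e) (path⇒sameRun (Edge.memberʳ e) p)

sameRun⇒member : ∀ (x : Vec Bool m) i j → sameRun x i j ≡ true → lookup x i ≡ true
sameRun⇒member x i j s = trans (sym (sameRun-refl x i)) (sameRun-trans x i j i s (trans (sameRun-sym x j i) s))

sameRun⇔path : ∀ (x : Vec Bool m) i j → sameRun x i j ≡ true ⇔ (lookup x i ≡ true × Star (Edge x) i j)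
sameRun⇔path x i j = mk⇔ (λ s → sameRun⇒member x i j s , sameRun⇒path x i j s) (λ (xi , p) → path⇒sameRun xi p)

≅-path : ∀ {x : Vec Bool a} {y : Vec Bool b} (ρ : x ≅ y) {i j} →
         Star (Edge x) i j → Star (Edge y) (σ ρ ⟨$⟩ʳ i) (σ ρ ⟨$⟩ʳ j)
≅-path ρ = gmap (σ ρ ⟨$⟩ʳ_) (to (edge-σ ρ _ _))

≅-sameRun : ∀ {x : Vec Bool a} {y : Vec Bool b} (ρ : x ≅ y) i j →
            sameRun y (σ ρ ⟨$⟩ʳ i) (σ ρ ⟨$⟩ʳ j) ≡ sameRun x i j
≅-sameRun {x = x} {y} ρ i j =
  ⇔→≡ (⇔.trans (sameRun⇔path y _ _) (⇔.trans (mk⇔ back forth) (⇔.sym (sameRun⇔path x i j))))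
  where
  forth : lookup x i ≡ true × Star (Edge x) i j → lookup y (σ ρ ⟨$⟩ʳ i) ≡ true × Star (Edge y) _ _
  forth (xi , p) = trans (sym (lookup-σ ρ i)) xi , ≅-path ρ p
  back : lookup y (σ ρ ⟨$⟩ʳ i) ≡ true × Star (Edge y) _ _ → lookup x i ≡ true × Star (Edge x) i j
  back (yi , q) = trans (lookup-σ ρ i) yi ,
    subst₂ (Star (Edge x)) (Perm.inverseˡ (σ ρ)) (Perm.inverseˡ (σ ρ)) (≅-path (≅-sym ρ) q)

runSize : Vec Bool m → Fin m → ℕ
runSize {m} x i = ∑[ j < m ] bit (sameRun x i j)

membersInRunsOfSize : ℕ → Vec Bool m → ℕ
membersInRunsOfSize {m} v x = ∑[ i < m ] bit (lookup x i ∧ (runSize x i ≡ᵇ v))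

≅-runSize : ∀ {x : Vec Bool a} {y : Vec Bool b} (ρ : x ≅ y) i → runSize y (σ ρ ⟨$⟩ʳ i) ≡ runSize x i
≅-runSize ρ i = trans (∑-permute _ (σ ρ)) (sum-cong-≗ (cong bit ∘ ≅-sameRun ρ i))

≅-membersInRunsOfSize : ∀ {x : Vec Bool a} {y : Vec Bool b} → x ≅ y →
                        ∀ v → membersInRunsOfSize v x ≡ membersInRunsOfSize v y
≅-membersInRunsOfSize ρ v = sym (trans (∑-permute _ (σ ρ))
  (sum-cong-≗ λ i → cong bit (cong₂ _∧_ (sym (lookup-σ ρ i)) (cong (_≡ᵇ v) (≅-runSize ρ i)))))

∑-split : ∀ a b (f : Fin (a + b) → ℕ) → ∑[ k < a + b ] f k ≡ ∑[ i < a ] f (i ↑ˡ b) + ∑[ j < b ] f (a ↑ʳ j)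
∑-split zero    b f = refl
∑-split (suc a) b f = trans (cong (f zero +_) (∑-split a b (f ∘ suc))) (sym (+-assoc (f zero) _ _))

∑-const : ∀ n c → ∑[ i < n ] c ≡ n * c
∑-const zero    c = refl
∑-const (suc n) c = cong (c +_) (∑-const n c)

∑-bit-false : ∀ n (f : Fin n → Bool) → (∀ i → f i ≡ false) → ∑[ i < n ] bit (f i) ≡ 0
∑-bit-false n f f≡false = trans (sum-cong-≗ (cong bit ∘ f≡false)) (sum-replicate-zero n)

allUpTo-↑ˡ : ∀ (x : Vec Bool a) (y : Vec Bool b) j → allUpTo (x ++ y) (j ↑ˡ b) ≡ allUpTo x j
allUpTo-↑ˡ (c ∷ x) y zero    = refl
allUpTo-↑ˡ (c ∷ x) y (suc j) = cong (c ∧_) (allUpTo-↑ˡ x y j)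

sameRun-↑ˡ : ∀ (x : Vec Bool a) (y : Vec Bool b) i j → sameRun (x ++ y) (i ↑ˡ b) (j ↑ˡ b) ≡ sameRun x i j
sameRun-↑ˡ (c ∷ x) y zero    j       = allUpTo-↑ˡ (c ∷ x) y j
sameRun-↑ˡ (c ∷ x) y (suc i) zero    = allUpTo-↑ˡ (c ∷ x) y (suc i)
sameRun-↑ˡ (c ∷ x) y (suc i) (suc j) = sameRun-↑ˡ x y i j

sameRun-↑ʳ : ∀ (x : Vec Bool a) (y : Vec Bool b) i j → sameRun (x ++ y) (a ↑ʳ i) (a ↑ʳ j) ≡ sameRun y i j
sameRun-↑ʳ []      y i j = refl
sameRun-↑ʳ (c ∷ x) y i j = sameRun-↑ʳ x y i j

allUpTo-across : (x : Vec Bool a) {y : Vec Bool b} → StartsOutside y → ∀ j → allUpTo (x ++ y) (a ↑ʳ j) ≡ false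
allUpTo-across []      false∷ zero    = refl
allUpTo-across []      false∷ (suc j) = refl
allUpTo-across (c ∷ x) y₀     j       = trans (cong (c ∧_) (allUpTo-across x y₀ j)) (∧-zeroʳ c)

sameRun-across : (x : Vec Bool a) {y : Vec Bool b} → StartsOutside y →
                 ∀ i j → sameRun (x ++ y) (i ↑ˡ b) (a ↑ʳ j) ≡ false
sameRun-across (c ∷ x) y₀ zero    j = allUpTo-across (c ∷ x) y₀ j
sameRun-across (c ∷ x) y₀ (suc i) j = sameRun-across x y₀ i j

module _ (x : Vec Bool a) {y : Vec Bool b} (y₀ : StartsOutside y) where

  runSize-↑ˡ : ∀ i → runSize (x ++ y) (i ↑ˡ b) ≡ runSize x i
  runSize-↑ˡ i = begin
    runSize (x ++ y) (i ↑ˡ b)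
      ≡⟨ ∑-split a b _ ⟩
    ∑[ j < a ] bit (sameRun (x ++ y) (i ↑ˡ b) (j ↑ˡ b)) + ∑[ j < b ] bit (sameRun (x ++ y) (i ↑ˡ b) (a ↑ʳ j))
      ≡⟨ cong₂ _+_ (sum-cong-≗ (cong bit ∘ sameRun-↑ˡ x y i)) (∑-bit-false b _ (sameRun-across x y₀ i)) ⟩
    runSize x i + 0
      ≡⟨ +-identityʳ _ ⟩
    runSize x i
      ∎
    where open ≡-Reasoning

  runSize-↑ʳ : ∀ j → runSize (x ++ y) (a ↑ʳ j) ≡ runSize y j
  runSize-↑ʳ j = trans (∑-split a b _) (cong₂ _+_
    (∑-bit-false a _ λ i → trans (sameRun-sym (x ++ y) (a ↑ʳ j) (i ↑ˡ b)) (sameRun-across x y₀ i j))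
    (sum-cong-≗ (cong bit ∘ sameRun-↑ʳ x y j)))

  membersInRunsOfSize-++ : ∀ v → membersInRunsOfSize v (x ++ y) ≡ membersInRunsOfSize v x + membersInRunsOfSize v y
  membersInRunsOfSize-++ v = trans (∑-split a b _) (cong₂ _+_
    (sum-cong-≗ λ i → cong bit (cong₂ _∧_ (lookup-++ˡ x y i) (cong (_≡ᵇ v) (runSize-↑ˡ i))))
    (sum-cong-≗ λ j → cong bit (cong₂ _∧_ (lookup-++ʳ x y j) (cong (_≡ᵇ v) (runSize-↑ʳ j)))))

allUpTo-replicate : ∀ k (j : Fin k) → allUpTo (replicate k true) j ≡ true
allUpTo-replicate (suc k) zero    = refl
allUpTo-replicate (suc k) (suc j) = allUpTo-replicate k j

runSize-replicate : ∀ k i → runSize (replicate k true) i ≡ k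
runSize-replicate k i = begin
  ∑[ j < k ] bit (sameRun (replicate k true) i j) ≡⟨ sum-cong-≗ (cong bit ∘ sameRun-replicate) ⟩
  ∑[ j < k ] 1                                    ≡⟨ ∑-const k 1 ⟩
  k * 1                                           ≡⟨ *-identityʳ k ⟩
  k                                               ∎
  where
  open ≡-Reasoning
  sameRun-replicate : ∀ j → sameRun (replicate k true) i j ≡ true
  sameRun-replicate j = allUpTo⇒sameRun (replicate k true) i j (allUpTo-replicate k i) (allUpTo-replicate k j)

membersInRunsOfSize-replicate : ∀ v k → membersInRunsOfSize v (replicate k true) ≡ k * bit (k ≡ᵇ v)
membersInRunsOfSize-replicate v k = trans
  (sum-cong-≗ λ i → cong bit (cong₂ _∧_ (lookup-replicate i true) (cong (_≡ᵇ v) (runSize-replicate k i))))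
  (∑-const k _)

*-bit-≡ᵇ : ∀ k v → k * bit (k ≡ᵇ v) ≡ v * bit (k ≡ᵇ v)
*-bit-≡ᵇ k v with k ≡ᵇ v in k≡ᵇv
... | true  = cong (_* 1) (≡ᵇ⇒≡ k v (subst T (sym k≡ᵇv) _))
... | false = trans (*-zeroʳ k) (sym (*-zeroʳ v))

membersInRunsOfSize-blocks : ∀ v ks → membersInRunsOfSize v (blocks ks) ≡ v * multiplicity v ks
membersInRunsOfSize-blocks v []       = sym (*-zeroʳ v)
membersInRunsOfSize-blocks v (k ∷ ks) = begin
  membersInRunsOfSize v (replicate k true ++ blocks ks)
    ≡⟨ membersInRunsOfSize-++ (replicate k true) (blocks-startsOutside ks) v ⟩
  membersInRunsOfSize v (replicate k true) + membersInRunsOfSize v (blocks ks)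
    ≡⟨ cong₂ _+_ (membersInRunsOfSize-replicate v k) (membersInRunsOfSize-blocks v ks) ⟩
  k * bit (k ≡ᵇ v) + v * multiplicity v ks
    ≡⟨ cong (_+ v * multiplicity v ks) (*-bit-≡ᵇ k v) ⟩
  v * bit (k ≡ᵇ v) + v * multiplicity v ks
    ≡⟨ *-distribˡ-+ v _ _ ⟨
  v * multiplicity v (k ∷ ks)
    ∎
  where open ≡-Reasoning

≅⇒runLengths-↭ : ∀ {x y : Vec Bool m} → x ≅ y → runLengths x ↭ runLengths y
≅⇒runLengths-↭ {x = x} {y} ρ = subst₂ _↭_ (sym (runLengths-view (runView x))) (sym (runLengths-view (runView y)))
                                          (positives-↭ (blocksOf x) (blocksOf y) same)
  where
  blocksOf : Vec Bool m → List ℕ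
  blocksOf z = blockLengths (runView z)
  -- membersInRunsOfSize v (false ∷ z) reduces to membersInRunsOfSize v z.
  counts : ∀ z v → membersInRunsOfSize v z ≡ v * multiplicity v (blocksOf z)
  counts z v = trans (≅-membersInRunsOfSize (false∷-≅-blocks (runView z)) v)
                     (membersInRunsOfSize-blocks v (blocksOf z))
  same : ∀ v → multiplicity (suc v) (blocksOf x) ≡ multiplicity (suc v) (blocksOf y)
  same v = *-cancelˡ-≡ _ _ (suc v)
    (trans (sym (counts x (suc v))) (trans (≅-membersInRunsOfSize ρ (suc v)) (counts y (suc v))))

-- Counting H_{I₁,I₂}

∈⇔lookup : ∀ {p : Subset m} {i} → i ∈ p ⇔ lookup p i ≡ true
∈⇔lookup = mk⇔ []=⇒lookup (lookup⇒[]= _ _)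

lookup≡⇒∈⇔∈ : ∀ {p q : Subset m} {i j} → lookup p i ≡ lookup q j → i ∈ p ⇔ j ∈ q
lookup≡⇒∈⇔∈ {p = p} {i = i} eq = ⇔.trans (subst (λ b → i ∈ p ⇔ b ≡ true) eq ∈⇔lookup) (⇔.sym ∈⇔lookup)

∈⇔∈⇒lookup≡ : ∀ {p q : Subset m} {i j} → i ∈ p ⇔ j ∈ q → lookup p i ≡ lookup q j
∈⇔∈⇒lookup≡ i∈p⇔j∈q = ⇔→≡ (⇔.trans (⇔.sym ∈⇔lookup) (⇔.trans i∈p⇔j∈q ∈⇔lookup))

∈-tabulate : ∀ {f : Fin m → Bool} {i} → i ∈ tabulate f ⇔ f i ≡ true
∈-tabulate {f = f} {i} = subst (λ b → i ∈ tabulate f ⇔ b ≡ true) (lookup∘tabulate f i) ∈⇔lookup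

all-allFin : ∀ (p : Fin m → Bool) → all p (List.allFin m) ≡ true ⇔ (∀ i → p i ≡ true)
all-allFin p = mk⇔
  (λ e i → to T-≡ (tabulate⁻ (all⁺ p _ (from T-≡ e)) i))
  (λ h → to T-≡ (all⁻ p (tabulate⁺ (from T-≡ ∘ h))))

∀-cong-⇔ : ∀ {I : Set} {P Q : I → Set} → (∀ i → P i ⇔ Q i) → (∀ i → P i) ⇔ (∀ i → Q i)
∀-cong-⇔ P⇔Q = mk⇔ (λ p i → to (P⇔Q i) (p i)) (λ q i → from (P⇔Q i) (q i))

x∈p─q⇒x∉q : ∀ {n} (p q : Subset n) {x} → x ∈ p ─ q → x ∉ q
x∈p─q⇒x∉q (true ∷ p) (false ∷ q) here       ()
x∈p─q⇒x∉q (_ ∷ p)    (_ ∷ q)     (there x∈) (there x∈q) = x∈p─q⇒x∉q p q x∈ x∈q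

∈─⇔ : ∀ {n} {p q : Subset n} {x} → x ∈ p ─ q ⇔ (x ∈ p × x ∉ q)
∈─⇔ {p = p} {q} = mk⇔ (λ x∈ → p─q⊆p p q x∈ , x∈p─q⇒x∉q p q x∈) (λ (x∈p , x∉q) → x∈p∧x∉q⇒x∈p─q x∈p x∉q)

∣p∣≡∣p∩q∣+∣p─q∣ : ∀ {n} (p q : Subset n) → ∣ p ∣ ≡ ∣ p ∩ q ∣ + ∣ p ─ q ∣
∣p∣≡∣p∩q∣+∣p─q∣ []          []          = refl
∣p∣≡∣p∩q∣+∣p─q∣ (true ∷ p)  (true ∷ q)  = cong suc (∣p∣≡∣p∩q∣+∣p─q∣ p q)
∣p∣≡∣p∩q∣+∣p─q∣ (true ∷ p)  (false ∷ q) = trans (cong suc (∣p∣≡∣p∩q∣+∣p─q∣ p q)) (sym (+-suc _ _))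
∣p∣≡∣p∩q∣+∣p─q∣ (false ∷ p) (true ∷ q)  = ∣p∣≡∣p∩q∣+∣p─q∣ p q
∣p∣≡∣p∩q∣+∣p─q∣ (false ∷ p) (false ∷ q) = ∣p∣≡∣p∩q∣+∣p─q∣ p q

clause⇔ : ∀ b c d → (not b ∨ c) ∧ (not d ∨ not c) ≡ true ⇔ ((b ≡ true → c ≡ true) × (d ≡ true → c ≢ true))
clause⇔ false false false = mk⇔ (λ _ → (λ ()) , (λ ())) (λ _ → refl)
clause⇔ false false true  = mk⇔ (λ _ → (λ ()) , (λ _ ())) (λ _ → refl)
clause⇔ false true  false = mk⇔ (λ _ → (λ _ → refl) , (λ ())) (λ _ → refl)
clause⇔ false true  true  = mk⇔ (λ ()) (λ (_ , c≢true) → ⊥-elim (c≢true refl refl))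
clause⇔ true  false d     = mk⇔ (λ ()) (λ (b⇒c , _) → b⇒c refl)
clause⇔ true  true  false = mk⇔ (λ _ → (λ _ → refl) , (λ ())) (λ _ → refl)
clause⇔ true  true  true  = mk⇔ (λ ()) (λ (_ , c≢true) → ⊥-elim (c≢true refl refl))

module _ {n m} (A : SetSystem n m) where

  Satisfies : Subset m → Subset m → Fin n → Set
  Satisfies I₁ I₂ x = ∀ i → (i ∈ I₁ → x ∈ A i) × (i ∈ I₂ → x ∉ A i)

  ∈-H₂ : ∀ I₁ I₂ {x} → x ∈ H₂ A I₁ I₂ ⇔ Satisfies I₁ I₂ x
  ∈-H₂ I₁ I₂ = ⇔.trans ∈-tabulate (⇔.trans (all-allFin _) (∀-cong-⇔ λ i → ⇔.trans (clause⇔ _ _ _)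
    (⇔.sym (→-cong-⇔ ∈⇔lookup ∈⇔lookup ×-⇔ →-cong-⇔ ∈⇔lookup (¬-cong-⇔ ∈⇔lookup)))))

  H₂-∪⁅⁆ : ∀ I₁ I₂ k → H₂ A (I₁ ∪ ⁅ k ⁆) (I₂ ─ ⁅ k ⁆) ≡ H₂ A I₁ (I₂ ─ ⁅ k ⁆) ∩ A k
  H₂-∪⁅⁆ I₁ I₂ k = ⊆-antisym lhs⊆rhs rhs⊆lhs
    where
    lhs⊆rhs : H₂ A (I₁ ∪ ⁅ k ⁆) (I₂ ─ ⁅ k ⁆) ⊆ H₂ A I₁ (I₂ ─ ⁅ k ⁆) ∩ A k
    lhs⊆rhs x∈ = x∈p∩q⁺ ( from (∈-H₂ I₁ (I₂ ─ ⁅ k ⁆)) (λ i → proj₁ (sat i) ∘ p⊆p∪q ⁅ k ⁆ , proj₂ (sat i))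
                  , proj₁ (sat k) (x∈p∪q⁺ (inj₂ (x∈⁅x⁆ k))))
      where sat = to (∈-H₂ (I₁ ∪ ⁅ k ⁆) (I₂ ─ ⁅ k ⁆)) x∈
    rhs⊆lhs : H₂ A I₁ (I₂ ─ ⁅ k ⁆) ∩ A k ⊆ H₂ A (I₁ ∪ ⁅ k ⁆) (I₂ ─ ⁅ k ⁆)
    rhs⊆lhs {x} x∈ = from (∈-H₂ (I₁ ∪ ⁅ k ⁆) (I₂ ─ ⁅ k ⁆)) λ i →
        Sum.[ proj₁ (sat i) , (λ i∈⁅k⁆ → subst (λ j → x ∈ A j) (sym (x∈⁅y⁆⇒x≡y k i∈⁅k⁆)) x∈Aₖ) ] ∘ x∈p∪q⁻ I₁ ⁅ k ⁆
      , proj₂ (sat i)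
      where
      x∈Aₖ = proj₂ (to ∩⇔× x∈)
      sat  = to (∈-H₂ I₁ (I₂ ─ ⁅ k ⁆)) (proj₁ (to ∩⇔× x∈))

  H₂-─⁅⁆ : ∀ I₁ {I₂ k} → k ∈ I₂ → H₂ A I₁ I₂ ≡ H₂ A I₁ (I₂ ─ ⁅ k ⁆) ─ A k
  H₂-─⁅⁆ I₁ {I₂} {k} k∈I₂ = ⊆-antisym lhs⊆rhs rhs⊆lhs
    where
    lhs⊆rhs : H₂ A I₁ I₂ ⊆ H₂ A I₁ (I₂ ─ ⁅ k ⁆) ─ A k
    lhs⊆rhs x∈ = x∈p∧x∉q⇒x∈p─q (from (∈-H₂ I₁ (I₂ ─ ⁅ k ⁆)) (λ i → proj₁ (sat i) , proj₂ (sat i) ∘ p─q⊆p I₂ ⁅ k ⁆))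
                         (proj₂ (sat k) k∈I₂)
      where sat = to (∈-H₂ I₁ I₂) x∈
    rhs⊆lhs : H₂ A I₁ (I₂ ─ ⁅ k ⁆) ─ A k ⊆ H₂ A I₁ I₂
    rhs⊆lhs x∈ = from (∈-H₂ I₁ I₂) λ i → proj₁ (sat i) , λ i∈I₂ → case i Fin.≟ k of λ where
        (yes refl) → x∉Aₖ
        (no i≢k)   → proj₂ (sat i) (x∈p∧x≢y⇒x∈p-y i∈I₂ i≢k)
      where
      x∉Aₖ = proj₂ (to ∈─⇔ x∈)
      sat  = to (∈-H₂ I₁ (I₂ ─ ⁅ k ⁆)) (proj₁ (to ∈─⇔ x∈))

  ∣H₂∣-split : ∀ I₁ {I₂ k} → k ∈ I₂ →
               ∣ H₂ A I₁ (I₂ ─ ⁅ k ⁆) ∣ ≡ ∣ H₂ A (I₁ ∪ ⁅ k ⁆) (I₂ ─ ⁅ k ⁆) ∣ + ∣ H₂ A I₁ I₂ ∣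
  ∣H₂∣-split I₁ {I₂} {k} k∈I₂ = trans (∣p∣≡∣p∩q∣+∣p─q∣ (H₂ A I₁ (I₂ ─ ⁅ k ⁆)) (A k))
    (sym (cong₂ _+_ (cong ∣_∣ (H₂-∪⁅⁆ I₁ I₂ k)) (cong ∣_∣ (H₂-─⁅⁆ I₁ k∈I₂))))

-- Equivalence witnesses

σ-≡⇔ : ∀ (σ : Permutation m m) {i k} → σ ⟨$⟩ʳ i ≡ σ ⟨$⟩ʳ k ⇔ i ≡ k
σ-≡⇔ σ = mk⇔ (λ eq → trans (sym (Perm.inverseˡ σ)) (trans (cong (σ ⟨$⟩ˡ_) eq) (Perm.inverseˡ σ))) (cong (σ ⟨$⟩ʳ_))

σ-⁅⁆⇔ : ∀ (σ : Permutation m m) {i k} → i ∈ ⁅ k ⁆ ⇔ σ ⟨$⟩ʳ i ∈ ⁅ σ ⟨$⟩ʳ k ⁆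
σ-⁅⁆⇔ σ = ⇔.trans x∈⁅y⁆⇔x≡y (⇔.trans (⇔.sym (σ-≡⇔ σ)) (⇔.sym x∈⁅y⁆⇔x≡y))

module _ {I J K L : Subset m} {i j} (i∈I⇔j∈J : i ∈ I ⇔ j ∈ J) (i∈K⇔j∈L : i ∈ K ⇔ j ∈ L) where

  ∪-cong-⇔ : i ∈ I ∪ K ⇔ j ∈ J ∪ L
  ∪-cong-⇔ = ⇔.trans (∪⇔⊎ {p = I}) (⇔.trans (i∈I⇔j∈J ⊎-⇔ i∈K⇔j∈L) (⇔.sym (∪⇔⊎ {p = J})))

  ─-cong-⇔ : i ∈ I ─ K ⇔ j ∈ J ─ L
  ─-cong-⇔ = ⇔.trans ∈─⇔ (⇔.trans (i∈I⇔j∈J ×-⇔ ¬-cong-⇔ i∈K⇔j∈L) (⇔.sym ∈─⇔))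

-- Witness as a record, so that its indices can be inferred.
record IsWitness (σ : Permutation m m) (I₁ I₂ J₁ J₂ : Subset m) : Set where
  field
    carries₁  : ∀ i → i ∈ I₁ ⇔ σ ⟨$⟩ʳ i ∈ J₁
    carries₂  : ∀ i → i ∈ I₂ ⇔ σ ⟨$⟩ʳ i ∈ J₂
    adjacency : ∀ i j → i ∈ I₁ ⊎ i ∈ I₂ → j ∈ I₁ ⊎ j ∈ I₂ → Adjacent (σ ⟨$⟩ʳ i) (σ ⟨$⟩ʳ j) ⇔ Adjacent i j
open IsWitness

isWitness : ∀ {σ : Permutation m m} {I₁ I₂ J₁ J₂} → Witness σ I₁ I₂ J₁ J₂ → IsWitness σ I₁ I₂ J₁ J₂
isWitness (c₁ , c₂ , adj) = record { carries₁ = c₁ ; carries₂ = c₂ ; adjacency = adj }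

module _ {σ : Permutation m m} {I₁ I₂ J₁ J₂ : Subset m} (w : IsWitness σ I₁ I₂ J₁ J₂) where

  private
    restrict : ∀ {I₁′ I₂′ : Subset m} → (∀ {i} → i ∈ I₁′ ⊎ i ∈ I₂′ → i ∈ I₁ ⊎ i ∈ I₂) →
               ∀ i j → i ∈ I₁′ ⊎ i ∈ I₂′ → j ∈ I₁′ ⊎ j ∈ I₂′ → Adjacent (σ ⟨$⟩ʳ i) (σ ⟨$⟩ʳ j) ⇔ Adjacent i j
    restrict shrink i j i∈ j∈ = adjacency w i j (shrink i∈) (shrink j∈)

  witness-─⁅⁆ : ∀ k → IsWitness σ I₁ (I₂ ─ ⁅ k ⁆) J₁ (J₂ ─ ⁅ σ ⟨$⟩ʳ k ⁆)
  witness-─⁅⁆ k = record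
    { carries₁  = carries₁ w
    ; carries₂  = λ i → ─-cong-⇔ (carries₂ w i) (σ-⁅⁆⇔ σ)
    ; adjacency = restrict (Sum.map₂ (p─q⊆p I₂ ⁅ k ⁆))
    }

  witness-move : ∀ {k} → k ∈ I₂ → IsWitness σ (I₁ ∪ ⁅ k ⁆) (I₂ ─ ⁅ k ⁆) (J₁ ∪ ⁅ σ ⟨$⟩ʳ k ⁆) (J₂ ─ ⁅ σ ⟨$⟩ʳ k ⁆)
  witness-move {k} k∈I₂ = record
    { carries₁  = λ i → ∪-cong-⇔ (carries₁ w i) (σ-⁅⁆⇔ σ)
    ; carries₂  = λ i → ─-cong-⇔ (carries₂ w i) (σ-⁅⁆⇔ σ)
    ; adjacency = restrict Sum.[ Sum.[ inj₁ , (λ i∈⁅k⁆ → inj₂ (subst (_∈ I₂) (sym (x∈⁅y⁆⇒x≡y k i∈⁅k⁆)) k∈I₂)) ]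
                                   ∘ x∈p∪q⁻ I₁ ⁅ k ⁆
                               , inj₂ ∘ p─q⊆p I₂ ⁅ k ⁆ ]
    }

  witness⇒≅ : I₁ ≅ J₁
  witness⇒≅ = record
    { σ        = σ
    ; lookup-σ = λ i → ∈⇔∈⇒lookup≡ (carries₁ w i)
    ; edge-σ   = λ i j → mk⇔
        (λ (edge Ii Ij adj) → edge (member Ii) (member Ij) (from (adjacent-σ Ii Ij) adj))
        (λ (edge Jσi Jσj adj) → let Ii = member⁻ Jσi ; Ij = member⁻ Jσj in edge Ii Ij (to (adjacent-σ Ii Ij) adj))
    }
    where
    member : ∀ {i} → lookup I₁ i ≡ true → lookup J₁ (σ ⟨$⟩ʳ i) ≡ true
    member = to ∈⇔lookup ∘ to (carries₁ w _) ∘ from ∈⇔lookup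
    member⁻ : ∀ {i} → lookup J₁ (σ ⟨$⟩ʳ i) ≡ true → lookup I₁ i ≡ true
    member⁻ = to ∈⇔lookup ∘ from (carries₁ w _) ∘ from ∈⇔lookup
    adjacent-σ : ∀ {i j} → lookup I₁ i ≡ true → lookup I₁ j ≡ true → Adjacent (σ ⟨$⟩ʳ i) (σ ⟨$⟩ʳ j) ⇔ Adjacent i j
    adjacent-σ Ii Ij = adjacency w _ _ (inj₁ (from ∈⇔lookup Ii)) (inj₁ (from ∈⇔lookup Ij))

  witness-Empty : Empty I₂ → Empty J₂
  witness-Empty I₂-empty (j , j∈J₂) =
    I₂-empty (σ ⟨$⟩ˡ j , from (carries₂ w _) (subst (_∈ J₂) (sym (Perm.inverseʳ σ)) j∈J₂))

-- The empty set as written in H₁, so that H₁ A I is definitionally H₂ A I ∅.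
∅ : Subset m
∅ = tabulate λ _ → false

∉∅ : ∀ {i : Fin m} → i ∉ ∅
∉∅ i∈∅ with () ← to ∈-tabulate i∈∅

Empty⇒≡∅ : ∀ {p : Subset m} → Empty p → p ≡ ∅
Empty⇒≡∅ empty = ⊆-antisym (λ x∈p → ⊥-elim (empty (_ , x∈p))) (⊥-elim ∘ ∉∅)

module _ {n m} (A : SetSystem n m) (harmonic : Harmonic A) where

  private
    Invariant : Subset m → Set
    Invariant I₂ = ∀ {I₁ J₁ J₂} σ → IsWitness σ I₁ I₂ J₁ J₂ → ∣ H₂ A I₁ I₂ ∣ ≡ ∣ H₂ A J₁ J₂ ∣

    step : ∀ I₂ → WfRec _⊂_ Invariant I₂ → Invariant I₂
    step I₂ rec {I₁} {J₁} {J₂} σ w with nonempty? I₂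
    ... | no I₂-empty = begin
      ∣ H₂ A I₁ I₂ ∣ ≡⟨ cong (∣_∣ ∘ H₂ A I₁) (Empty⇒≡∅ I₂-empty) ⟩
      ∣ H₁ A I₁ ∣    ≡⟨ harmonic I₁ J₁ (≅⇒runLengths-↭ (witness⇒≅ w)) ⟩
      ∣ H₁ A J₁ ∣    ≡⟨ cong (∣_∣ ∘ H₂ A J₁) (Empty⇒≡∅ (witness-Empty w I₂-empty)) ⟨
      ∣ H₂ A J₁ J₂ ∣ ∎
      where open ≡-Reasoning
    ... | yes (k , k∈I₂) = +-cancelˡ-≡ ∣ H₂ A (I₁ ∪ ⁅ k ⁆) (I₂ ─ ⁅ k ⁆) ∣ _ _ (begin
      ∣ H₂ A (I₁ ∪ ⁅ k ⁆) (I₂ ─ ⁅ k ⁆) ∣ + ∣ H₂ A I₁ I₂ ∣    ≡⟨ ∣H₂∣-split A I₁ k∈I₂ ⟨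
      ∣ H₂ A I₁ (I₂ ─ ⁅ k ⁆) ∣                               ≡⟨ rec smaller σ (witness-─⁅⁆ w k) ⟩
      ∣ H₂ A J₁ (J₂ ─ ⁅ k′ ⁆) ∣                              ≡⟨ ∣H₂∣-split A J₁ (to (carries₂ w k) k∈I₂) ⟩
      ∣ H₂ A (J₁ ∪ ⁅ k′ ⁆) (J₂ ─ ⁅ k′ ⁆) ∣ + ∣ H₂ A J₁ J₂ ∣  ≡⟨ cong (_+ _) (rec smaller σ (witness-move w k∈I₂)) ⟨
      ∣ H₂ A (I₁ ∪ ⁅ k ⁆) (I₂ ─ ⁅ k ⁆) ∣ + ∣ H₂ A J₁ J₂ ∣    ∎)
      where
      open ≡-Reasoning
      k′ = σ ⟨$⟩ʳ k
      smaller = x∈p⇒p-x⊂p k∈I₂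

  harmonic⇒witness-invariant : ∀ {I₁ I₂ J₁ J₂} σ → IsWitness σ I₁ I₂ J₁ J₂ → ∣ H₂ A I₁ I₂ ∣ ≡ ∣ H₂ A J₁ J₂ ∣
  harmonic⇒witness-invariant {I₂ = I₂} = All.wfRec ⊂-wellFounded 0ℓ Invariant step I₂

≅⇒Equivalent : ∀ {I J : Subset m} → I ≅ J → Equivalent I ∅ J ∅
≅⇒Equivalent {I = I} {J} ρ = (λ _ _ → ∉∅) , (λ _ _ → ∉∅) , σ ρ , carries , (λ _ → ⇔-⊥ ∉∅ ∉∅) , adjacent
  where
  carries : ∀ i → i ∈ I ⇔ σ ρ ⟨$⟩ʳ i ∈ J
  carries i = lookup≡⇒∈⇔∈ (lookup-σ ρ i)
  adjacent : ∀ i j → i ∈ I ⊎ i ∈ ∅ → j ∈ I ⊎ j ∈ ∅ → Adjacent (σ ρ ⟨$⟩ʳ i) (σ ρ ⟨$⟩ʳ j) ⇔ Adjacent i j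
  adjacent i j (inj₁ i∈I) (inj₁ j∈I) = mk⇔
    (λ adj → Edge.adjacent (from (edge-σ ρ i j) (edge (member i∈I) (member j∈I) adj)))
    (λ adj → Edge.adjacent (to (edge-σ ρ i j) (edge (to ∈⇔lookup i∈I) (to ∈⇔lookup j∈I) adj)))
    where member = λ {k} (k∈I : k ∈ I) → to ∈⇔lookup (to (carries k) k∈I)
  adjacent i j (inj₂ i∈∅) _          = ⊥-elim (∉∅ i∈∅)
  adjacent i j (inj₁ _)   (inj₂ j∈∅) = ⊥-elim (∉∅ j∈∅)

lemma3p22 : (n m : ℕ) (A : SetSystem n m) →
    Harmonic A ⇔
      ((I₁ I₂ J₁ J₂ : Subset m) → Equivalent I₁ I₂ J₁ J₂ →
        ∣ H₂ A I₁ I₂ ∣ ≡ ∣ H₂ A J₁ J₂ ∣)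
lemma3p22 n m A = mk⇔
  (λ harmonic I₁ I₂ J₁ J₂ (_ , _ , σ , w) → harmonic⇒witness-invariant A harmonic σ (isWitness w))
  (λ invariant I J same → invariant I ∅ J ∅ (≅⇒Equivalent (runLengths-↭⇒≅ same)))
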